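{- Let $(x,y)$ be a feasible solution to $(\mathrm{LP}_{\mathrm{FLM}})$ for an FLM instance with compatibility graph $G=(V,E)$, and let $M$ be a maximum matching of $G$. In any iteration of $\textsc{Reroute}((x,y),M)$, the current pair $(\tilde x,2y)$ is feasible to $(\mathrm{LP}_{\mathrm{FLM}})$.
   Context: An FLM instance $(F,V,E,f,d)$: finite sets $F$, $V$, a metric $d$ on $F\cup V$, $f:F\to\mathbb{R}_{\ge0}$, $E\subseteq\binom V2$; $G=(V,E)$. For $i\in F$, $e=\{j,k\}\in E$: $d(i,e):=d(i,j)+d(i,k)$. $\delta(v)$: edges incident to $v$. $P_{\mathrm{MM}}(G)$: convex hull of characteristic vectors $\chi^{M'}$ of maximum matchings $M'$ of $G$. $(\mathrm{LP}_{\mathrm{FLM}})$: minimize $\sum_if(i)y_i+\sum_{i,e}d(i,e)x_{i,e}$ over $x\in\mathbb{R}^{F\times E}$, $y\in\mathbb{R}^F$ s.t. $(x_e)_e\in P_{\mathrm{MM}}(G)$ where $x_e:=\sum_ix_{i,e}$; $\sum_{e\in\delta(j)}x_{i,e}\le y_i$ for all $i\in F,j\in V$; $x,y\ge0$. $\textsc{Reroute}((x,y),M)$: set $\tilde x:=x$ and compute $\gamma\ge0$ indexed by maximum matchings, with $O(|E|)$ nonzero entries and $\sum\gamma_{M'}=1$, such that $\tilde x_e=\sum_{M'}\gamma_{M'}\chi^{M'}_e$ for all $e$. While $\gamma_M<1$ (one iteration): pick a maximum matching $M'\ne M$ with $\gamma_{M'}>0$; pick a maximal alternating path or cycle $P=e_1,\dots,e_\ell$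 in $M\triangle M'$ with $\ell$ even, odd-indexed edges in $M'$, even-indexed edges in $M$; for each $e'\in M'\cap P$ choose $i_{e'}$ with $\tilde x_{i_{e'},e'}>0$; $\varepsilon:=\min\{\gamma_{M'},\min_{e'\in M'\cap P}\tilde x_{i_{e'},e'}\}$; for each $e'\in M'\cap P$, with $e\in M\cap P$ the next edge after $e'$ along $P$, decrease $\tilde x_{i_{e'},e'}$ by $\varepsilon$ and increase $\tilde x_{i_{e'},e}$ by $\varepsilon$; decrease $\gamma_{M'}$ by $\varepsilon$, increase $\gamma_{M'\triangle P}$ by $\varepsilon$. Output $(\tilde x,2y)$.
   Formalization: The feasible solution $(x,y)$, the coefficients γ of the decomposition, the metric $d$ and the opening costs $f$ take rational values instead of real ones. -}

module Defs where

open import Data.Nat as ℕ using (ℕ; zero; suc; pred; _∸_)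
open import Data.Fin as Fin using (Fin)
open import Data.Fin.Subset using (Subset; _∈_; _∉_; ∣_∣; inside; outside)
open import Data.Bool using (Bool; true; false; if_then_else_; _∧_; _xor_)
open import Data.Vec as Vec using (Vec; lookup; tabulate; []; _∷_)
import Data.Vec.Properties as VecP
open import Data.List as List using (List; []; _∷_; upTo; foldr; map; _++_)
open import Data.Bool.ListAction using (any)
open import Data.Product using (Σ; ∃; _×_; _,_; proj₁; proj₂)
open import Data.Sum using (_⊎_)
open import Data.Rational using (ℚ; 0ℚ; 1ℚ; _+_; _-_; _⊓_; _≤_; _<_)
open import Relation.Binary.PropositionalEquality using (_≡_; _≢_)
open import Relation.Nullary.Decidable using (⌊_⌋)
open import Relation.Nullary using (¬_)
import Data.Bool.Properties as BoolP

sumFin : {n : ℕ} → (Fin n → ℚ) → ℚ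
sumFin {zero}  f = 0ℚ
sumFin {suc n} f = f Fin.zero + sumFin (λ i → f (Fin.suc i))

sumList : List ℚ → ℚ
sumList = foldr _+_ 0ℚ

allSubsets : (k : ℕ) → List (Subset k)
allSubsets zero    = [] ∷ []
allSubsets (suc k) = map (inside ∷_) (allSubsets k) ++ map (outside ∷_) (allSubsets k)

sumSubsets : {k : ℕ} → (Subset k → ℚ) → ℚ
sumSubsets {k} c = sumList (map c (allSubsets k))

_≟S_ : {k : ℕ} → (A B : Subset k) → Relation.Nullary.Dec (A ≡ B)
_≟S_ = VecP.≡-dec BoolP._≟_

-- Graphs G = (V, E), V = Fin n, E = Fin k, edge e joins proj₁ (ends e)
-- and proj₂ (ends e); no loops, no parallel edges (E ⊆ (V choose 2)).

record Graph : Set where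
  field
    n    : ℕ
    k    : ℕ
    ends : Fin k → Fin n × Fin n
    loopless : ∀ e → proj₁ (ends e) ≢ proj₂ (ends e)
    simple   : ∀ e e' →
      (proj₁ (ends e) ≡ proj₁ (ends e') × proj₂ (ends e) ≡ proj₂ (ends e'))
      ⊎ (proj₁ (ends e) ≡ proj₂ (ends e') × proj₂ (ends e) ≡ proj₁ (ends e'))
      → e ≡ e'

module _ (G : Graph) where
  open Graph G

  Incident : Fin n → Fin k → Set
  Incident v e = (proj₁ (ends e) ≡ v) ⊎ (proj₂ (ends e) ≡ v)

  incident? : Fin n → Fin k → Bool
  incident? v e = ⌊ proj₁ (ends e) Fin.≟ v ⌋ Data.Bool.∨ ⌊ proj₂ (ends e) Fin.≟ v ⌋

  Joins : Fin k → Fin n → Fin n → Set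
  Joins e a b = (proj₁ (ends e) ≡ a × proj₂ (ends e) ≡ b)
              ⊎ (proj₁ (ends e) ≡ b × proj₂ (ends e) ≡ a)

  IsMatching : Subset k → Set
  IsMatching M = ∀ e e' → e ∈ M → e' ∈ M → e ≢ e' →
                 ∀ v → ¬ (Incident v e × Incident v e')

  IsMaximumMatching : Subset k → Set
  IsMaximumMatching M = IsMatching M × (∀ N → IsMatching N → ∣ N ∣ ℕ.≤ ∣ M ∣)

  χ : Subset k → Fin k → ℚ
  χ N e = if lookup N e then 1ℚ else 0ℚ

  IsMMDecomposition : (Fin k → ℚ) → (Subset k → ℚ) → Set
  IsMMDecomposition z γ =
      (∀ N → 0ℚ ≤ γ N)
    × (∀ N → γ N ≢ 0ℚ → IsMaximumMatching N)
    × sumSubsets γ ≡ 1ℚ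
    × (∀ e → z e ≡ sumSubsets (λ N → if lookup N e then γ N else 0ℚ))

  -- z ∈ P_MM(G) = conv { χ^N : N maximum matching of G }
  InPMM : (Fin k → ℚ) → Set
  InPMM z = ∃ λ (γ : Subset k → ℚ) → IsMMDecomposition z γ

-- FLM instances (F = Fin m; points of F ∪ V are Fin m ⊎ Fin n)

record FLM : Set where
  field
    m : ℕ
    G : Graph
  open Graph G public
  Point : Set
  Point = Fin m ⊎ Fin n
  field
    d : Point → Point → ℚ
    f : Fin m → ℚ
    f-nonneg  : ∀ i → 0ℚ ≤ f i
    d-nonneg  : ∀ p q → 0ℚ ≤ d p q
    d-zero    : ∀ p → d p p ≡ 0ℚ
    d-sym     : ∀ p q → d p q ≡ d q p
    d-triangle : ∀ p q r → d p r ≤ d p q + d q r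

module _ (I : FLM) where
  open FLM I

  -- feasibility for (LP_FLM); x i e = x_{i,e}, y i = y_i
  Feasible : (Fin m → Fin k → ℚ) → (Fin m → ℚ) → Set
  Feasible x y =
      InPMM G (λ e → sumFin (λ i → x i e))
    × (∀ i j → sumFin (λ e → if incident? G j e then x i e else 0ℚ) ≤ y i)
    × (∀ i e → 0ℚ ≤ x i e)
    × (∀ i → 0ℚ ≤ y i)

  record State : Set where
    constructor ⟨_,_⟩
    field
      xt : Fin m → Fin k → ℚ
      γ  : Subset k → ℚ
  open State public

  shift : (Fin m → Fin k → ℚ) → Fin m → Fin k → Fin k → ℚ
        → (Fin m → Fin k → ℚ)
  shift x i a b ε i' g =
    if ⌊ i' Fin.≟ i ⌋ ∧ ⌊ g Fin.≟ a ⌋ then x i' g - ε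
    else if ⌊ i' Fin.≟ i ⌋ ∧ ⌊ g Fin.≟ b ⌋ then x i' g + ε
    else x i' g

  bump : (Subset k → ℚ) → Subset k → ℚ → (Subset k → ℚ)
  bump γ A δ N = if ⌊ N ≟S A ⌋ then γ N + δ else γ N

  -- The path/cycle P = e_1,…,e_ℓ with
  -- ℓ = 2r, r ≥ 1, is given by e : ℕ → Fin k (indices 1..ℓ used) and its
  -- vertex sequence v : ℕ → Fin n (indices 0..ℓ used), e_t = {v_{t-1}, v_t}.
  -- ι s is the chosen facility i_{e'} for e' = e_{2s+1} (s < r).
  data Step (M : Subset k) : State → State → Set where
    step : (x̃ : Fin m → Fin k → ℚ) (γ : Subset k → ℚ)
      → γ M < 1ℚ
      → (M' : Subset k) → M' ≢ M → 0ℚ < γ M'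
      → (r : ℕ) → 1 ℕ.≤ r
      → (e : ℕ → Fin k) (v : ℕ → Fin n)
      → (∀ t → 1 ℕ.≤ t → t ℕ.≤ 2 ℕ.* r → Joins G (e t) (v (pred t)) (v t))
      → (∀ t t' → 1 ℕ.≤ t → t ℕ.≤ 2 ℕ.* r → 1 ℕ.≤ t' → t' ℕ.≤ 2 ℕ.* r
           → e t ≡ e t' → t ≡ t')
      → (∀ s → s ℕ.< r → (e (suc (2 ℕ.* s)) ∈ M') × (e (suc (2 ℕ.* s)) ∉ M))
      → (∀ s → s ℕ.< r → (e (2 ℕ.+ 2 ℕ.* s) ∈ M) × (e (2 ℕ.+ 2 ℕ.* s) ∉ M'))
      -- P is a maximal path, or a cycle, in M △ M'
      → ( ( (∀ a b → a ℕ.≤ 2 ℕ.* r → b ℕ.≤ 2 ℕ.* r → v a ≡ v b → a ≡ b)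
          × (∀ g → ((g ∈ M × g ∉ M') ⊎ (g ∈ M' × g ∉ M))
               → (Incident G (v 0) g ⊎ Incident G (v (2 ℕ.* r)) g)
               → ∃ λ t → 1 ℕ.≤ t × t ℕ.≤ 2 ℕ.* r × e t ≡ g) )
        ⊎ ( v 0 ≡ v (2 ℕ.* r)
          × (∀ a b → a ℕ.< 2 ℕ.* r → b ℕ.< 2 ℕ.* r → v a ≡ v b → a ≡ b) ) )
      → (ι : ℕ → Fin m)
      → (∀ s → s ℕ.< r → 0ℚ < x̃ (ι s) (e (suc (2 ℕ.* s))))
      → let ε : ℚ
            ε = foldr (λ s acc → acc ⊓ x̃ (ι s) (e (suc (2 ℕ.* s)))) (γ M') (upTo r)
            inP : Fin k → Bool
            inP g = any (λ t → ⌊ e t Fin.≟ g ⌋) (map suc (upTo (2 ℕ.* r)))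
            M'△P : Subset k
            M'△P = tabulate (λ g → lookup M' g xor inP g)
            x̃' = foldr (λ s x → shift x (ι s) (e (suc (2 ℕ.* s))) (e (2 ℕ.+ 2 ℕ.* s)) ε)
                       x̃ (upTo r)
            γ' = bump (bump γ M' (0ℚ - ε)) M'△P ε
        in Step M ⟨ x̃ , γ ⟩ ⟨ x̃' , γ' ⟩

{-# OPTIONS --safe #-}
module Submission where

-- Reroute only moves weight of a facility i from an edge a ∈ M′ ∖ M of P to the next edge
-- b ∈ M ∖ M′ of P, which shares a vertex u with a.  Call the off-load of i at a vertex j the
-- weight of i on the edges at j outside M.  The invariant is: x̃ ≥ 0, every off-load of i is at
-- most y i, and for every h = pq ∈ M, x̃ i h plus the off-loads of i at p and at q is at most
-- 2 y i.  It holds initially by the degree constraints of (x, y).  A transfer never increases an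
-- off-load, and what it adds to x̃ i b is removed from the off-load of i at u, an end of b, so
-- the invariant survives.  As M is a matching, the load of i at j is at most x̃ i h plus the
-- off-load at j, for the edge h ∈ M at j (if any), hence at most 2 y i.  Meanwhile γ moves
-- weight ε from M′ to M′ △ P, again a maximum matching: it is a matching by the maximality of P,
-- and it has the size of M′ because exchanging the odd and the even edges of P is an involution.

open import Defs
open import Data.Fin using (Fin)
open import Data.Fin.Subset using (Subset)
open import Data.Rational using (ℚ; _+_)
open import Relation.Binary.Construct.Closure.ReflexiveTransitive using (Star)

open import Data.Bool using (Bool; true; false; if_then_else_; _xor_)
open import Data.Bool.ListAction using (any)
import Data.Bool.Properties as BoolP
open import Data.Empty using (⊥; ⊥-elim)
import Data.Fin as Fin
import Data.Fin.Permutation as Perm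
import Data.Fin.Properties as FinP
open import Data.Fin.Subset using (_∈_; _∉_; ∣_∣; inside; outside)
open import Data.Fin.Subset.Properties using (_∈?_)
open import Data.List as List using (List; []; _∷_; map; foldr; upTo)
open import Data.List.Membership.Propositional using (find; lose) renaming (_∈_ to _∈ₗ_)
open import Data.List.Membership.Propositional.Properties using (∈-map⁺; ∈-upTo⁺; ∈-upTo⁻)
import Data.List.Properties as ListP
open import Data.List.Relation.Unary.All as All using (All; []; _∷_)
open import Data.List.Relation.Unary.AllPairs using ([]; _∷_)
open import Data.List.Relation.Unary.Any using (here; there)
import Data.List.Relation.Unary.Any.Properties as AnyP
open import Data.List.Relation.Unary.Any.Properties using (any⁺; any⁻)
open import Data.List.Relation.Unary.Unique.Propositional using (Unique)
import Data.List.Relation.Unary.Unique.Propositional.Properties as UniqueP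
open import Data.Nat as ℕ using (ℕ; zero; suc; pred)
import Data.Nat.Properties as NP
open import Data.Product using (∃; _×_; _,_; proj₁; proj₂)
open import Data.Rational using (0ℚ; 1ℚ; -_; _-_; _⊓_; _≤_; _<_)
import Data.Rational.Properties as QP
open import Data.Rational.Solver using (module +-*-Solver)
open import Data.Sum using (_⊎_; inj₁; inj₂; [_,_]′)
open import Data.Vec using (lookup; tabulate; _∷_; [])
import Data.Vec.Properties as VecP
open import Function using (_∘_; id)
open import Function.Bundles using (Equivalence)
import Relation.Binary.Construct.Closure.ReflexiveTransitive as RT
open import Relation.Binary.PropositionalEquality
open import Relation.Nullary using (¬_; yes; no)
open import Relation.Nullary.Decidable using (Dec; ⌊_⌋; _⊎-dec_; _×-dec_; dec-true; dec-false; isYes≗does; ⌊⌋-map′; toWitness; fromWitness)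

open import Algebra.Bundles using (CommutativeMonoid)
open import Algebra.Properties.CommutativeMonoid.Sum QP.+-0-commutativeMonoid using (sum; ∑-distrib-+)
open import Algebra.Properties.CommutativeSemigroup (CommutativeMonoid.commutativeSemigroup QP.+-0-commutativeMonoid) using () renaming (interchange to +-interchange)
import Algebra.Properties.CommutativeMonoid.Sum NP.+-0-commutativeMonoid as ℕΣ

s<r⇒1+2s≤2r : ∀ {s r} → s ℕ.< r → suc (2 ℕ.* s) ℕ.≤ 2 ℕ.* r
s<r⇒1+2s≤2r = NP.*-monoʳ-< 2

s<r⇒2+2s≤2r : ∀ {s r} → s ℕ.< r → 2 ℕ.+ 2 ℕ.* s ℕ.≤ 2 ℕ.* r
s<r⇒2+2s≤2r {s} {r} s<r = subst (ℕ._≤ 2 ℕ.* r) (NP.*-suc 2 s) (NP.*-monoʳ-≤ 2 s<r)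

t<2r⇒halve : ∀ {r} t → t ℕ.< 2 ℕ.* r → ∃ λ s → s ℕ.< r × (t ≡ 2 ℕ.* s ⊎ t ≡ suc (2 ℕ.* s))
t<2r⇒halve {r} zero 0<2r = 0 , NP.*-cancelˡ-< 2 0 r 0<2r , inj₁ refl
t<2r⇒halve {r} (suc t) t+1<2r with t<2r⇒halve {r} t (NP.<-trans (NP.n<1+n t) t+1<2r)
... | s , s<r , inj₁ refl = s , s<r , inj₂ refl
... | s , s<r , inj₂ refl = suc s , NP.*-cancelˡ-< 2 (suc s) r (subst (ℕ._< 2 ℕ.* r) (sym (NP.*-suc 2 s)) t+1<2r)
                                  , inj₁ (sym (NP.*-suc 2 s))

open +-*-Solver

+-moveʳ : ∀ {x e y} → x + e ≡ y → x ≡ y - e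
+-moveʳ {x} {e} refl = solve 2 (λ x e → x := (x :+ e) :- e) refl x e

-+-cancel : ∀ x e → (x - e) + e ≡ x
-+-cancel = solve 2 (λ x e → (x :- e) :+ e := x) refl

x≤x+c : ∀ {c} x → 0ℚ ≤ c → x ≤ x + c
x≤x+c {c} x 0≤c = subst (_≤ x + c) (QP.+-identityʳ x) (QP.+-monoʳ-≤ x 0≤c)

x-c≤x : ∀ {c} x → 0ℚ ≤ c → x - c ≤ x
x-c≤x {c} x 0≤c = subst (x - c ≤_) (-+-cancel x c) (x≤x+c (x - c) 0≤c)

+-slackˡ : ∀ {x e a a′ b b′} → a′ + e ≤ a → b′ ≤ b → (x + e) + a′ + b′ ≤ x + a + b
+-slackˡ {x} {e} {a} {a′} {b} {b′} a′+e≤a b′≤b =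
  subst (_≤ x + a + b) (solve 4 (λ x e a′ b′ → x :+ (a′ :+ e) :+ b′ := (x :+ e) :+ a′ :+ b′) refl x e a′ b′)
        (QP.+-mono-≤ (QP.+-monoʳ-≤ x a′+e≤a) b′≤b)

+-slackʳ : ∀ {x e a a′ b b′} → a′ ≤ a → b′ + e ≤ b → (x + e) + a′ + b′ ≤ x + a + b
+-slackʳ {x} {e} {a} {a′} {b} {b′} a′≤a b′+e≤b =
  subst (_≤ x + a + b) (solve 4 (λ x e a′ b′ → x :+ a′ :+ (b′ :+ e) := (x :+ e) :+ a′ :+ b′) refl x e a′ b′)
        (QP.+-mono-≤ (QP.+-monoʳ-≤ x a′≤a) b′+e≤b)

0≤+ : ∀ {x y} → 0ℚ ≤ x → 0ℚ ≤ y → 0ℚ ≤ x + y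
0≤+ = QP.+-mono-≤

0≤- : ∀ {e x} → e ≤ x → 0ℚ ≤ x - e
0≤- {e} {x} e≤x = subst (_≤ x - e) (QP.+-inverseʳ e) (QP.+-monoˡ-≤ (- e) e≤x)

-- Finite sums

sumFin-cong : ∀ {n} {f g : Fin n → ℚ} → (∀ i → f i ≡ g i) → sumFin f ≡ sumFin g
sumFin-cong {zero}  f≗g = refl
sumFin-cong {suc n} f≗g = cong₂ _+_ (f≗g Fin.zero) (sumFin-cong (f≗g ∘ Fin.suc))

sumFin-mono : ∀ {n} {f g : Fin n → ℚ} → (∀ i → f i ≤ g i) → sumFin f ≤ sumFin g
sumFin-mono {zero}  f≤g = QP.≤-refl
sumFin-mono {suc n} f≤g = QP.+-mono-≤ (f≤g Fin.zero) (sumFin-mono (f≤g ∘ Fin.suc))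

sumFin-zero : ∀ n → sumFin {n} (λ _ → 0ℚ) ≡ 0ℚ
sumFin-zero zero    = refl
sumFin-zero (suc n) = trans (QP.+-identityˡ _) (sumFin-zero n)

sumFin-nonneg : ∀ {n} {f : Fin n → ℚ} → (∀ i → 0ℚ ≤ f i) → 0ℚ ≤ sumFin f
sumFin-nonneg {n} {f} 0≤f = subst (_≤ sumFin f) (sumFin-zero n) (sumFin-mono 0≤f)

sumFin≡sum : ∀ {n} (f : Fin n → ℚ) → sumFin f ≡ sum f
sumFin≡sum {zero}  f = refl
sumFin≡sum {suc n} f = cong (f Fin.zero +_) (sumFin≡sum (f ∘ Fin.suc))

sumFin-+ : ∀ {n} (f g : Fin n → ℚ) → sumFin (λ i → f i + g i) ≡ sumFin f + sumFin g
sumFin-+ f g = begin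
  sumFin (λ i → f i + g i) ≡⟨ sumFin≡sum (λ i → f i + g i) ⟩
  sum (λ i → f i + g i)    ≡⟨ ∑-distrib-+ f g ⟩
  sum f + sum g            ≡⟨ cong₂ _+_ (sumFin≡sum f) (sumFin≡sum g) ⟨
  sumFin f + sumFin g      ∎
  where open ≡-Reasoning

sumFin-single : ∀ {n} (a : Fin n) c → sumFin (λ i → if ⌊ i FinP.≟ a ⌋ then c else 0ℚ) ≡ c
sumFin-single {suc n} Fin.zero    c = trans (cong (c +_) (sumFin-zero n)) (QP.+-identityʳ c)
sumFin-single {suc n} (Fin.suc a) c =
  trans (QP.+-identityˡ _) (trans (sumFin-cong shifted) (sumFin-single a c))
  where
  shifted : ∀ i → (if ⌊ Fin.suc i FinP.≟ Fin.suc a ⌋ then c else 0ℚ) ≡ (if ⌊ i FinP.≟ a ⌋ then c else 0ℚ)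
  shifted i = cong (if_then c else 0ℚ) (⌊⌋-map′ _ _ (i FinP.≟ a))

sumFin-+-single : ∀ {n} (f : Fin n → ℚ) (a : Fin n) c →
  sumFin (λ i → f i + (if ⌊ i FinP.≟ a ⌋ then c else 0ℚ)) ≡ sumFin f + c
sumFin-+-single f a c = trans (sumFin-+ f _) (cong (sumFin f +_) (sumFin-single a c))

sumFin-mono-single : ∀ {n} {f g : Fin n → ℚ} (a : Fin n) c →
  (∀ i → f i + (if ⌊ i FinP.≟ a ⌋ then c else 0ℚ) ≤ g i) → sumFin f + c ≤ sumFin g
sumFin-mono-single {f = f} {g} a c f+c≤g = subst (_≤ sumFin g) (sumFin-+-single f a c) (sumFin-mono f+c≤g)

sumList-++ : ∀ xs ys → sumList (xs List.++ ys) ≡ sumList xs + sumList ys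
sumList-++ []       ys = sym (QP.+-identityˡ _)
sumList-++ (x ∷ xs) ys = trans (cong (x +_) (sumList-++ xs ys)) (sym (QP.+-assoc x _ _))

sumList-map-+ : ∀ {A : Set} (f g : A → ℚ) xs →
  sumList (map (λ x → f x + g x) xs) ≡ sumList (map f xs) + sumList (map g xs)
sumList-map-+ f g []       = sym (QP.+-identityˡ 0ℚ)
sumList-map-+ f g (x ∷ xs) =
  trans (cong (f x + g x +_) (sumList-map-+ f g xs)) (+-interchange (f x) (g x) _ _)

sumSubsets-cong : ∀ {k} {f g : Subset k → ℚ} → (∀ Q → f Q ≡ g Q) → sumSubsets f ≡ sumSubsets g
sumSubsets-cong {k} f≗g = cong sumList (ListP.map-cong f≗g (allSubsets k))

sumSubsets-+ : ∀ {k} (f g : Subset k → ℚ) → sumSubsets (λ Q → f Q + g Q) ≡ sumSubsets f + sumSubsets g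
sumSubsets-+ {k} f g = sumList-map-+ f g (allSubsets k)

sumSubsets-suc : ∀ {k} (f : Subset (suc k) → ℚ) →
  sumSubsets f ≡ sumSubsets (f ∘ (inside ∷_)) + sumSubsets (f ∘ (outside ∷_))
sumSubsets-suc {k} f = begin
  sumList (map f (map (inside ∷_) S List.++ map (outside ∷_) S))
    ≡⟨ cong sumList (ListP.map-++ f (map (inside ∷_) S) _) ⟩
  sumList (map f (map (inside ∷_) S) List.++ map f (map (outside ∷_) S))
    ≡⟨ sumList-++ (map f (map (inside ∷_) S)) _ ⟩
  sumList (map f (map (inside ∷_) S)) + sumList (map f (map (outside ∷_) S))
    ≡⟨ cong₂ (λ xs ys → sumList xs + sumList ys) (ListP.map-∘ S) (ListP.map-∘ S) ⟨
  sumSubsets (f ∘ (inside ∷_)) + sumSubsets (f ∘ (outside ∷_)) ∎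
  where
  open ≡-Reasoning
  S : List (Subset k)
  S = allSubsets k

sumSubsets-zero : ∀ k → sumSubsets {k} (λ _ → 0ℚ) ≡ 0ℚ
sumSubsets-zero zero    = QP.+-identityʳ 0ℚ
sumSubsets-zero (suc k) =
  trans (sumSubsets-suc {k} (λ _ → 0ℚ)) (trans (cong₂ _+_ (sumSubsets-zero k) (sumSubsets-zero k)) (QP.+-identityʳ 0ℚ))

≟S-∷ : ∀ {k} x (Q A : Subset k) → ⌊ (x ∷ Q) ≟S (x ∷ A) ⌋ ≡ ⌊ Q ≟S A ⌋
≟S-∷ x Q A with Q ≟S A | x
... | yes _ | true  = refl
... | yes _ | false = refl
... | no _  | true  = refl
... | no _  | false = refl

sumSubsets-single : ∀ {k} (A : Subset k) c → sumSubsets (λ Q → if ⌊ Q ≟S A ⌋ then c else 0ℚ) ≡ c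
sumSubsets-single []      c = QP.+-identityʳ c
sumSubsets-single {suc k} (x ∷ A) c = begin
  sumSubsets (λ Q → if ⌊ Q ≟S (x ∷ A) ⌋ then c else 0ℚ)
    ≡⟨ sumSubsets-suc {k} (λ Q → if ⌊ Q ≟S (x ∷ A) ⌋ then c else 0ℚ) ⟩
  sumSubsets (λ Q → if ⌊ (inside ∷ Q) ≟S (x ∷ A) ⌋ then c else 0ℚ)
    + sumSubsets (λ Q → if ⌊ (outside ∷ Q) ≟S (x ∷ A) ⌋ then c else 0ℚ)
    ≡⟨ split x ⟩
  c ∎
  where
  open ≡-Reasoning
  matching : ∀ y → sumSubsets (λ Q → if ⌊ (y ∷ Q) ≟S (y ∷ A) ⌋ then c else 0ℚ) ≡ c
  matching y = trans (sumSubsets-cong (λ Q → cong (if_then c else 0ℚ) (≟S-∷ y Q A))) (sumSubsets-single A c)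
  split : ∀ x → sumSubsets (λ Q → if ⌊ (inside ∷ Q) ≟S (x ∷ A) ⌋ then c else 0ℚ)
                + sumSubsets (λ Q → if ⌊ (outside ∷ Q) ≟S (x ∷ A) ⌋ then c else 0ℚ) ≡ c
  split true  = trans (cong₂ _+_ (matching true) (sumSubsets-zero k)) (QP.+-identityʳ c)
  split false = trans (cong₂ _+_ (sumSubsets-zero k) (matching false)) (QP.+-identityˡ c)

module _ {A : Set} (t : A → ℚ) where

  ⊓-fold : ℚ → List A → ℚ
  ⊓-fold c = foldr (λ s m → m ⊓ t s) c

  ⊓-fold-≤-init : ∀ c xs → ⊓-fold c xs ≤ c
  ⊓-fold-≤-init c []       = QP.≤-refl
  ⊓-fold-≤-init c (s ∷ xs) = QP.≤-trans (QP.p⊓q≤p (⊓-fold c xs) (t s)) (⊓-fold-≤-init c xs)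

  ⊓-fold-≤-∈ : ∀ c {s} xs → s ∈ₗ xs → ⊓-fold c xs ≤ t s
  ⊓-fold-≤-∈ c (s ∷ xs)  (here refl) = QP.p⊓q≤q (⊓-fold c xs) (t s)
  ⊓-fold-≤-∈ c (s′ ∷ xs) (there s∈)  = QP.≤-trans (QP.p⊓q≤p (⊓-fold c xs) (t s′)) (⊓-fold-≤-∈ c xs s∈)

  ⊓-fold-nonneg : ∀ {c} xs → 0ℚ ≤ c → (∀ {s} → s ∈ₗ xs → 0ℚ ≤ t s) → 0ℚ ≤ ⊓-fold c xs
  ⊓-fold-nonneg []       0≤c 0≤t = 0≤c
  ⊓-fold-nonneg (s ∷ xs) 0≤c 0≤t = QP.⊓-glb (⊓-fold-nonneg xs 0≤c (0≤t ∘ there)) (0≤t (here refl))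

-- Graphs and matchings

⌊⌋-yes : ∀ {A : Set} (a? : Dec A) → A → ⌊ a? ⌋ ≡ true
⌊⌋-yes a? a = trans (isYes≗does a?) (dec-true a? a)

⌊⌋-no : ∀ {A : Set} (a? : Dec A) → ¬ A → ⌊ a? ⌋ ≡ false
⌊⌋-no a? ¬a = trans (isYes≗does a?) (dec-false a? ¬a)

∈⇒lookup : ∀ {k} {S : Subset k} {g} → g ∈ S → lookup S g ≡ true
∈⇒lookup = VecP.[]=⇒lookup

lookup⇒∈ : ∀ {k} {S : Subset k} {g} → lookup S g ≡ true → g ∈ S
lookup⇒∈ {S = S} {g} = VecP.lookup⇒[]= g S

lookup⇒∉ : ∀ {k} {S : Subset k} {g} → lookup S g ≡ false → g ∉ S
lookup⇒∉ S[g]≡false g∈S with () ← trans (sym (∈⇒lookup g∈S)) S[g]≡false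

∉⇒lookup : ∀ {k} {S : Subset k} {g} → g ∉ S → lookup S g ≡ false
∉⇒lookup {S = S} {g} g∉S with lookup S g in eq
... | true  = ⊥-elim (g∉S (lookup⇒∈ eq))
... | false = refl

module _ (G : Graph) where
  open Graph G

  incident?-complete : ∀ {v e} → Incident G v e → incident? G v e ≡ true
  incident?-complete {v} {e} (inj₁ p) rewrite ⌊⌋-yes (proj₁ (ends e) FinP.≟ v) p = refl
  incident?-complete {v} {e} (inj₂ p) rewrite ⌊⌋-yes (proj₂ (ends e) FinP.≟ v) p = BoolP.∨-zeroʳ _

  incident?-sound : ∀ {v e} → incident? G v e ≡ true → Incident G v e
  incident?-sound {v} {e} _  with proj₁ (ends e) FinP.≟ v | proj₂ (ends e) FinP.≟ v
  incident?-sound         _  | yes p | _     = inj₁ p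
  incident?-sound         _  | no _  | yes p = inj₂ p

  joins⇒incidentˡ : ∀ {h p q} → Joins G h p q → Incident G p h
  joins⇒incidentˡ (inj₁ (p≡ , _)) = inj₁ p≡
  joins⇒incidentˡ (inj₂ (_ , p≡)) = inj₂ p≡

  joins⇒incidentʳ : ∀ {h p q} → Joins G h p q → Incident G q h
  joins⇒incidentʳ (inj₁ (_ , q≡)) = inj₂ q≡
  joins⇒incidentʳ (inj₂ (q≡ , _)) = inj₁ q≡

  incident-joins : ∀ {u h p q} → Incident G u h → Joins G h p q → u ≡ p ⊎ u ≡ q
  incident-joins (inj₁ refl) (inj₁ (p≡ , _)) = inj₁ p≡
  incident-joins (inj₁ refl) (inj₂ (q≡ , _)) = inj₂ q≡
  incident-joins (inj₂ refl) (inj₁ (_ , q≡)) = inj₂ q≡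
  incident-joins (inj₂ refl) (inj₂ (_ , p≡)) = inj₁ p≡

  incident⇒joins : ∀ {u h} → Incident G u h → ∃ λ w → Joins G h u w
  incident⇒joins {h = h} (inj₁ u≡) = proj₂ (ends h) , inj₁ (u≡ , refl)
  incident⇒joins {h = h} (inj₂ u≡) = proj₁ (ends h) , inj₂ (refl , u≡)

  Incident-dec : ∀ v e → Dec (Incident G v e)
  Incident-dec v e = (proj₁ (ends e) FinP.≟ v) ⊎-dec (proj₂ (ends e) FinP.≟ v)

  matching-unique : ∀ {S} → IsMatching G S → ∀ {g g′ w} → g ∈ S → g′ ∈ S →
                    Incident G w g → Incident G w g′ → g ≡ g′
  matching-unique match {g} {g′} {w} g∈S g′∈S w∼g w∼g′ with g FinP.≟ g′
  ... | yes g≡g′ = g≡g′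
  ... | no  g≢g′ = ⊥-elim (match g g′ g∈S g′∈S g≢g′ w (w∼g , w∼g′))

∣∣≡sum : ∀ {k} (S : Subset k) → ∣ S ∣ ≡ ℕΣ.sum (λ g → if lookup S g then 1 else 0)
∣∣≡sum []            = refl
∣∣≡sum (inside ∷ S)  = cong suc (∣∣≡sum S)
∣∣≡sum (outside ∷ S) = ∣∣≡sum S

∣∣-involution : ∀ {k} (S T : Subset k) (σ : Fin k → Fin k) → (∀ g → σ (σ g) ≡ g) →
                (∀ g → lookup S (σ g) ≡ lookup T g) → ∣ T ∣ ≡ ∣ S ∣
∣∣-involution S T σ σσ≗id S∘σ≗T = begin
  ∣ T ∣                                                  ≡⟨ ∣∣≡sum T ⟩
  ℕΣ.sum (λ g → if lookup T g then 1 else 0)             ≡⟨ ℕΣ.sum-cong-≗ (cong (if_then 1 else 0) ∘ S∘σ≗T) ⟨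
  ℕΣ.sum (λ g → if lookup S (σ g) then 1 else 0)         ≡⟨ ℕΣ.sum-permute _ (Perm.permutation σ σ σσ≗id σσ≗id) ⟨
  ℕΣ.sum (λ g → if lookup S g then 1 else 0)             ≡⟨ ∣∣≡sum S ⟨
  ∣ S ∣                                                  ∎
  where open ≡-Reasoning

-- Transfers and convex combinations

module _ (I : FLM) where
  open FLM I

  edgeTotal : (Fin m → Fin k → ℚ) → Fin k → ℚ
  edgeTotal X g = sumFin (λ i → X i g)

  module _ (X : Fin m → Fin k → ℚ) (i : Fin m) (a b : Fin k) (ε : ℚ) where

    shift-source : shift I X i a b ε i a ≡ X i a - ε
    shift-source rewrite ⌊⌋-yes (i FinP.≟ i) refl | ⌊⌋-yes (a FinP.≟ a) refl = refl

    shift-target : a ≢ b → shift I X i a b ε i b ≡ X i b + ε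
    shift-target a≢b
      rewrite ⌊⌋-yes (i FinP.≟ i) refl | ⌊⌋-no (b FinP.≟ a) (a≢b ∘ sym) | ⌊⌋-yes (b FinP.≟ b) refl = refl

    shift-otherFacility : ∀ {i′} g → i′ ≢ i → shift I X i a b ε i′ g ≡ X i′ g
    shift-otherFacility {i′} g i′≢i rewrite ⌊⌋-no (i′ FinP.≟ i) i′≢i = refl

    shift-otherEdge : ∀ i′ {g} → g ≢ a → g ≢ b → shift I X i a b ε i′ g ≡ X i′ g
    shift-otherEdge i′ {g} g≢a g≢b rewrite ⌊⌋-no (g FinP.≟ a) g≢a | ⌊⌋-no (g FinP.≟ b) g≢b
      with ⌊ i′ FinP.≟ i ⌋
    ... | true  = refl
    ... | false = refl

    shift-nonneg : (∀ i′ g → 0ℚ ≤ X i′ g) → 0ℚ ≤ ε → ε ≤ X i a → ∀ i′ g → 0ℚ ≤ shift I X i a b ε i′ g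
    shift-nonneg 0≤X 0≤ε ε≤Xa i′ g with i′ FinP.≟ i | g FinP.≟ a | g FinP.≟ b
    ... | no _     | _        | _        = 0≤X i′ g
    ... | yes refl | yes refl | _        = 0≤- ε≤Xa
    ... | yes refl | no _     | yes refl = 0≤+ (0≤X i b) 0≤ε
    ... | yes refl | no _     | no _     = 0≤X i g

    shift-≤ : 0ℚ ≤ ε → ∀ i′ g → g ≢ b → shift I X i a b ε i′ g ≤ X i′ g
    shift-≤ 0≤ε i′ g g≢b with i′ FinP.≟ i | g FinP.≟ a | g FinP.≟ b
    ... | no _     | _        | _        = QP.≤-refl
    ... | yes refl | yes refl | _        = x-c≤x (X i a) 0≤ε
    ... | yes refl | no _     | yes refl = ⊥-elim (g≢b refl)
    ... | yes refl | no _     | no _     = QP.≤-refl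

    private
      εAt : Fin m → ℚ
      εAt i′ = if ⌊ i′ FinP.≟ i ⌋ then ε else 0ℚ

    edgeTotal-shift-source : edgeTotal (shift I X i a b ε) a ≡ edgeTotal X a - ε
    edgeTotal-shift-source =
      +-moveʳ (trans (sym (sumFin-+-single (λ i′ → shift I X i a b ε i′ a) i ε))
                     (sumFin-cong (λ i′ → pointwise i′ (i′ FinP.≟ i))))
      where
      pointwise : ∀ i′ → Dec (i′ ≡ i) → shift I X i a b ε i′ a + εAt i′ ≡ X i′ a
      pointwise i′ (yes refl) rewrite shift-source | ⌊⌋-yes (i′ FinP.≟ i′) refl = -+-cancel (X i′ a) ε
      pointwise i′ (no i′≢i) rewrite shift-otherFacility a i′≢i | ⌊⌋-no (i′ FinP.≟ i) i′≢i = QP.+-identityʳ _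

    edgeTotal-shift-target : a ≢ b → edgeTotal (shift I X i a b ε) b ≡ edgeTotal X b + ε
    edgeTotal-shift-target a≢b =
      trans (sumFin-cong (λ i′ → pointwise i′ (i′ FinP.≟ i))) (sumFin-+-single (λ i′ → X i′ b) i ε)
      where
      pointwise : ∀ i′ → Dec (i′ ≡ i) → shift I X i a b ε i′ b ≡ X i′ b + εAt i′
      pointwise i′ (yes refl) rewrite shift-target a≢b | ⌊⌋-yes (i′ FinP.≟ i′) refl = refl
      pointwise i′ (no i′≢i) rewrite shift-otherFacility b i′≢i | ⌊⌋-no (i′ FinP.≟ i) i′≢i = sym (QP.+-identityʳ _)

    edgeTotal-shift-other : ∀ {g} → g ≢ a → g ≢ b → edgeTotal (shift I X i a b ε) g ≡ edgeTotal X g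
    edgeTotal-shift-other g≢a g≢b = sumFin-cong (λ i′ → shift-otherEdge i′ g≢a g≢b)

  bump-nonneg : ∀ {γ : Subset k → ℚ} {A δ} → (∀ Q → 0ℚ ≤ γ Q) → 0ℚ ≤ γ A + δ → ∀ Q → 0ℚ ≤ bump I γ A δ Q
  bump-nonneg {A = A} 0≤γ 0≤γA+δ Q with Q ≟S A
  ... | yes refl = 0≤γA+δ
  ... | no _     = 0≤γ Q

  bump-support : ∀ {γ : Subset k → ℚ} {A δ} (P : Subset k → Set) →
    (∀ Q → γ Q ≢ 0ℚ → P Q) → P A → ∀ Q → bump I γ A δ Q ≢ 0ℚ → P Q
  bump-support {A = A} P γ-support PA Q with Q ≟S A
  ... | yes refl = λ _ → PA
  ... | no _     = γ-support Q

  sumSubsets-bump : ∀ (w : Subset k → Bool) (γ : Subset k → ℚ) A δ →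
    sumSubsets (λ Q → if w Q then bump I γ A δ Q else 0ℚ)
      ≡ sumSubsets (λ Q → if w Q then γ Q else 0ℚ) + (if w A then δ else 0ℚ)
  sumSubsets-bump w γ A δ = begin
    sumSubsets (λ Q → if w Q then bump I γ A δ Q else 0ℚ)    ≡⟨ sumSubsets-cong pointwise ⟩
    sumSubsets (λ Q → wγ Q + (if ⌊ Q ≟S A ⌋ then δA else 0ℚ)) ≡⟨ sumSubsets-+ wγ _ ⟩
    sumSubsets wγ + sumSubsets (λ Q → if ⌊ Q ≟S A ⌋ then δA else 0ℚ)
                                                               ≡⟨ cong (sumSubsets wγ +_) (sumSubsets-single A δA) ⟩
    sumSubsets wγ + δA                                         ∎
    where
    open ≡-Reasoning
    wγ : Subset k → ℚ
    wγ Q = if w Q then γ Q else 0ℚ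
    δA : ℚ
    δA = if w A then δ else 0ℚ
    pointwise : ∀ Q → (if w Q then bump I γ A δ Q else 0ℚ) ≡ wγ Q + (if ⌊ Q ≟S A ⌋ then δA else 0ℚ)
    pointwise Q with Q ≟S A
    pointwise Q | yes refl with w Q
    ... | true  = refl
    ... | false = sym (QP.+-identityʳ 0ℚ)
    pointwise Q | no _ = sym (QP.+-identityʳ _)

  IsMMDecomposition-exchange : ∀ {z z′ : Fin k → ℚ} {γ A B ε} →
    IsMMDecomposition G z γ → IsMaximumMatching G A → IsMaximumMatching G B → 0ℚ ≤ ε → ε ≤ γ A →
    (∀ g → z′ g ≡ (z g + (if lookup A g then 0ℚ - ε else 0ℚ)) + (if lookup B g then ε else 0ℚ)) →
    IsMMDecomposition G z′ (bump I (bump I γ A (0ℚ - ε)) B ε)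
  IsMMDecomposition-exchange {z} {z′} {γ} {A} {B} {ε} (0≤γ , γ-support , Σγ≡1 , z≡Σγ) A-max B-max 0≤ε ε≤γA z′≡ =
    bump-nonneg (bump-nonneg 0≤γ 0≤γA-ε) (0≤+ (bump-nonneg 0≤γ 0≤γA-ε B) 0≤ε)
    , bump-support (IsMaximumMatching G) (bump-support (IsMaximumMatching G) γ-support A-max) B-max
    , total
    , edge
    where
    0≤γA-ε : 0ℚ ≤ γ A + (0ℚ - ε)
    0≤γA-ε = subst (λ d → 0ℚ ≤ γ A + d) (sym (QP.+-identityˡ _)) (0≤- ε≤γA)
    total : sumSubsets (bump I (bump I γ A (0ℚ - ε)) B ε) ≡ 1ℚ
    total = begin
      sumSubsets (bump I (bump I γ A (0ℚ - ε)) B ε) ≡⟨ sumSubsets-bump (λ _ → true) _ B ε ⟩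
      sumSubsets (bump I γ A (0ℚ - ε)) + ε          ≡⟨ cong (_+ ε) (sumSubsets-bump (λ _ → true) γ A (0ℚ - ε)) ⟩
      (sumSubsets γ + (0ℚ - ε)) + ε                 ≡⟨ cong (λ s → (s + (0ℚ - ε)) + ε) Σγ≡1 ⟩
      (1ℚ + (0ℚ - ε)) + ε                           ≡⟨ solve 1 (λ e → (con 1ℚ :+ (con 0ℚ :- e)) :+ e := con 1ℚ) refl ε ⟩
      1ℚ                                            ∎
      where open ≡-Reasoning
    edge : ∀ g → z′ g ≡ sumSubsets (λ Q → if lookup Q g then bump I (bump I γ A (0ℚ - ε)) B ε Q else 0ℚ)
    edge g = begin
      z′ g
        ≡⟨ z′≡ g ⟩
      (z g + (if lookup A g then 0ℚ - ε else 0ℚ)) + (if lookup B g then ε else 0ℚ)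
        ≡⟨ cong (λ s → (s + _) + _) (z≡Σγ g) ⟩
      (sumSubsets (λ Q → if lookup Q g then γ Q else 0ℚ) + (if lookup A g then 0ℚ - ε else 0ℚ))
        + (if lookup B g then ε else 0ℚ)
        ≡⟨ cong (_+ _) (sumSubsets-bump (λ Q → lookup Q g) γ A (0ℚ - ε)) ⟨
      sumSubsets (λ Q → if lookup Q g then bump I γ A (0ℚ - ε) Q else 0ℚ) + (if lookup B g then ε else 0ℚ)
        ≡⟨ sumSubsets-bump (λ Q → lookup Q g) _ B ε ⟨
      sumSubsets (λ Q → if lookup Q g then bump I (bump I γ A (0ℚ - ε)) B ε Q else 0ℚ) ∎
      where open ≡-Reasoning

-- The load invariant

module Load (I : FLM) (M : Subset (FLM.k I)) (y : Fin (FLM.m I) → ℚ) where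
  open FLM I

  load : (Fin m → Fin k → ℚ) → Fin m → Fin n → ℚ
  load X i j = sumFin (λ g → if incident? G j g then X i g else 0ℚ)

  offEdge : (Fin m → Fin k → ℚ) → Fin m → Fin n → Fin k → ℚ
  offEdge X i j g = if incident? G j g then (if lookup M g then 0ℚ else X i g) else 0ℚ

  offLoad : (Fin m → Fin k → ℚ) → Fin m → Fin n → ℚ
  offLoad X i j = sumFin (offEdge X i j)

  record LoadBounded (X : Fin m → Fin k → ℚ) : Set where
    field
      nonneg     : ∀ i g → 0ℚ ≤ X i g
      offLoad≤y  : ∀ i j → offLoad X i j ≤ y i
      matched≤2y : ∀ i {h p q} → h ∈ M → Joins G h p q → X i h + offLoad X i p + offLoad X i q ≤ y i + y i

  offLoad-nonneg : ∀ {X} i j → (∀ g → 0ℚ ≤ X i g) → 0ℚ ≤ offLoad X i j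
  offLoad-nonneg {X} i j 0≤X = sumFin-nonneg pointwise
    where
    pointwise : ∀ g → 0ℚ ≤ offEdge X i j g
    pointwise g with incident? G j g | lookup M g
    ... | true  | true  = QP.≤-refl
    ... | true  | false = 0≤X g
    ... | false | _     = QP.≤-refl

  offEdge-mono : ∀ {X X′} i j → (∀ g → g ∉ M → X′ i g ≤ X i g) → ∀ g → offEdge X′ i j g ≤ offEdge X i j g
  offEdge-mono i j X′≤X g with incident? G j g | lookup M g in g∈?M
  ... | true  | true  = QP.≤-refl
  ... | true  | false = X′≤X g (lookup⇒∉ g∈?M)
  ... | false | _     = QP.≤-refl

  offLoad-mono : ∀ {X X′} i j → (∀ g → g ∉ M → X′ i g ≤ X i g) → offLoad X′ i j ≤ offLoad X i j
  offLoad-mono {X} {X′} i j X′≤X = sumFin-mono (offEdge-mono {X} {X′} i j X′≤X)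

  offLoad-decrease : ∀ {X X′ i u a ε} → Incident G u a → a ∉ M → X′ i a + ε ≤ X i a →
    (∀ g → g ∉ M → X′ i g ≤ X i g) → offLoad X′ i u + ε ≤ offLoad X i u
  offLoad-decrease {X} {X′} {i} {u} {a} {ε} u∼a a∉M X′a+ε≤Xa X′≤X = sumFin-mono-single a ε pointwise
    where
    pointwise : ∀ g → offEdge X′ i u g + (if ⌊ g FinP.≟ a ⌋ then ε else 0ℚ) ≤ offEdge X i u g
    pointwise g with g FinP.≟ a
    ... | yes refl rewrite incident?-complete G u∼a | ∉⇒lookup a∉M = X′a+ε≤Xa
    ... | no _     = subst (_≤ offEdge X i u g) (sym (QP.+-identityʳ _)) (offEdge-mono {X} {X′} i u X′≤X g)

  LoadBounded-init : ∀ {X} → (∀ i g → 0ℚ ≤ X i g) → (∀ i j → load X i j ≤ y i) → LoadBounded X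
  LoadBounded-init {X} 0≤X load≤y = record { nonneg = 0≤X ; offLoad≤y = offLoad≤y ; matched≤2y = matched≤2y }
    where
    offEdge≤edge : ∀ i j g → offEdge X i j g ≤ (if incident? G j g then X i g else 0ℚ)
    offEdge≤edge i j g with incident? G j g | lookup M g
    ... | true  | true  = 0≤X i g
    ... | true  | false = QP.≤-refl
    ... | false | _     = QP.≤-refl

    offLoad≤y : ∀ i j → offLoad X i j ≤ y i
    offLoad≤y i j = QP.≤-trans (sumFin-mono (offEdge≤edge i j)) (load≤y i j)

    matched≤2y : ∀ i {h p q} → h ∈ M → Joins G h p q → X i h + offLoad X i p + offLoad X i q ≤ y i + y i
    matched≤2y i {h} {p} {q} h∈M h=pq =
      subst (_≤ y i + y i) (cong (_+ offLoad X i q) (QP.+-comm (offLoad X i p) (X i h)))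
        (QP.+-mono-≤ (QP.≤-trans (sumFin-mono-single h (X i h) pointwise) (load≤y i p)) (offLoad≤y i q))
      where
      pointwise : ∀ g → offEdge X i p g + (if ⌊ g FinP.≟ h ⌋ then X i h else 0ℚ) ≤ (if incident? G p g then X i g else 0ℚ)
      pointwise g with g FinP.≟ h
      ... | yes refl rewrite incident?-complete G (joins⇒incidentˡ G h=pq) | ∈⇒lookup h∈M =
        QP.≤-reflexive (QP.+-identityˡ _)
      ... | no _ = subst (_≤ _) (sym (QP.+-identityʳ _)) (offEdge≤edge i p g)

  LoadBounded⇒load≤2y : IsMatching G M → (∀ i → 0ℚ ≤ y i) → ∀ {X} → LoadBounded X →
                        ∀ i j → load X i j ≤ y i + y i
  LoadBounded⇒load≤2y M-match 0≤y {X} bounded i j with FinP.any? (λ h → (h ∈? M) ×-dec Incident-dec G j h)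
  ... | yes (h , h∈M , j∼h) = begin
    load X i j                                       ≤⟨ sumFin-mono pointwise ⟩
    sumFin (λ g → offEdge X i j g + (if ⌊ g FinP.≟ h ⌋ then X i h else 0ℚ))
                                                     ≡⟨ sumFin-+-single (offEdge X i j) h (X i h) ⟩
    offLoad X i j + X i h                            ≡⟨ QP.+-comm (offLoad X i j) (X i h) ⟩
    X i h + offLoad X i j                            ≤⟨ x≤x+c _ (offLoad-nonneg {X} i w (nonneg i)) ⟩
    X i h + offLoad X i j + offLoad X i w            ≤⟨ matched≤2y i h∈M (proj₂ (incident⇒joins G j∼h)) ⟩
    y i + y i                                        ∎
    where
    open QP.≤-Reasoning
    open LoadBounded bounded
    w : Fin n
    w = proj₁ (incident⇒joins G j∼h)
    pointwise : ∀ g → (if incident? G j g then X i g else 0ℚ) ≤ offEdge X i j g + (if ⌊ g FinP.≟ h ⌋ then X i h else 0ℚ)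
    pointwise g with g FinP.≟ h
    ... | yes refl rewrite incident?-complete G j∼h | ∈⇒lookup h∈M = QP.≤-reflexive (sym (QP.+-identityˡ _))
    ... | no g≢h with incident? G j g in j∼?g | lookup M g in g∈?M
    ...   | true  | true  = ⊥-elim (g≢h (matching-unique G M-match (lookup⇒∈ g∈?M) h∈M (incident?-sound G j∼?g) j∼h))
    ...   | true  | false = QP.≤-reflexive (sym (QP.+-identityʳ _))
    ...   | false | _     = QP.≤-reflexive (sym (QP.+-identityʳ _))
  ... | no ∄h = begin
    load X i j      ≤⟨ sumFin-mono pointwise ⟩
    offLoad X i j   ≤⟨ LoadBounded.offLoad≤y bounded i j ⟩
    y i             ≤⟨ x≤x+c (y i) (0≤y i) ⟩
    y i + y i       ∎
    where
    open QP.≤-Reasoning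
    pointwise : ∀ g → (if incident? G j g then X i g else 0ℚ) ≤ offEdge X i j g
    pointwise g with incident? G j g in j∼?g | lookup M g in g∈?M
    ... | true  | true  = ⊥-elim (∄h (g , lookup⇒∈ g∈?M , incident?-sound G j∼?g))
    ... | true  | false = QP.≤-refl
    ... | false | _     = QP.≤-refl

  shift-LoadBounded : ∀ {X i a b u ε} → a ∉ M → b ∈ M → Incident G u a → Incident G u b →
    0ℚ ≤ ε → ε ≤ X i a → LoadBounded X → LoadBounded (shift I X i a b ε)
  shift-LoadBounded {X} {i} {a} {b} {u} {ε} a∉M b∈M u∼a u∼b 0≤ε ε≤Xa bounded = record
    { nonneg     = shift-nonneg I X i a b ε nonneg 0≤ε ε≤Xa
    ; offLoad≤y  = λ i′ j → QP.≤-trans (offLoad-mono {X} {X′} i′ j (X′≤X i′)) (offLoad≤y i′ j)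
    ; matched≤2y = matched≤2y′
    }
    where
    open LoadBounded bounded

    X′ : Fin m → Fin k → ℚ
    X′ = shift I X i a b ε

    a≢b : a ≢ b
    a≢b refl = a∉M b∈M

    X′≤X : ∀ i′ g → g ∉ M → X′ i′ g ≤ X i′ g
    X′≤X i′ g g∉M = shift-≤ I X i a b ε 0≤ε i′ g (λ where refl → g∉M b∈M)

    offLoad′+ε≤offLoad : offLoad X′ i u + ε ≤ offLoad X i u
    offLoad′+ε≤offLoad = offLoad-decrease {X} {X′} u∼a a∉M
      (QP.≤-reflexive (trans (cong (_+ ε) (shift-source I X i a b ε)) (-+-cancel (X i a) ε))) (X′≤X i)

    target≤ : ∀ {p q} → u ≡ p ⊎ u ≡ q → X′ i b + offLoad X′ i p + offLoad X′ i q ≤ X i b + offLoad X i p + offLoad X i q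
    target≤ {p} {q} u∈pq rewrite shift-target I X i a b ε a≢b with u∈pq
    ... | inj₁ refl = +-slackˡ {X i b} {ε} offLoad′+ε≤offLoad (offLoad-mono {X} {X′} i q (X′≤X i))
    ... | inj₂ refl = +-slackʳ {X i b} {ε} (offLoad-mono {X} {X′} i p (X′≤X i)) offLoad′+ε≤offLoad

    unchanged≤ : ∀ i′ {h p q} → h ∈ M → Joins G h p q → X′ i′ h ≡ X i′ h →
                 X′ i′ h + offLoad X′ i′ p + offLoad X′ i′ q ≤ y i′ + y i′
    unchanged≤ i′ {h} {p} {q} h∈M h=pq X′h≡Xh = QP.≤-trans
      (QP.+-mono-≤ (QP.+-mono-≤ (QP.≤-reflexive X′h≡Xh) (offLoad-mono {X} {X′} i′ p (X′≤X i′)))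
                   (offLoad-mono {X} {X′} i′ q (X′≤X i′)))
      (matched≤2y i′ h∈M h=pq)

    matched≤2y′ : ∀ i′ {h p q} → h ∈ M → Joins G h p q → X′ i′ h + offLoad X′ i′ p + offLoad X′ i′ q ≤ y i′ + y i′
    matched≤2y′ i′ {h} h∈M h=pq = cases i′ h h∈M h=pq (i′ FinP.≟ i) (h FinP.≟ b)
      where
      cases : ∀ i′ h {p q} → h ∈ M → Joins G h p q → Dec (i′ ≡ i) → Dec (h ≡ b) →
              X′ i′ h + offLoad X′ i′ p + offLoad X′ i′ q ≤ y i′ + y i′
      cases _ _ h∈M h=pq (yes refl) (yes refl) =
        QP.≤-trans (target≤ (incident-joins G u∼b h=pq)) (matched≤2y i h∈M h=pq)
      cases i′ h h∈M h=pq (no i′≢i) _ = unchanged≤ i′ h∈M h=pq (shift-otherFacility I X i a b ε h i′≢i)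
      cases _ h h∈M h=pq (yes refl) (no h≢b) =
        unchanged≤ i h∈M h=pq (shift-otherEdge I X i a b ε i (λ where refl → a∉M h∈M) h≢b)

-- One iteration of Reroute

module Iteration
  (I : FLM) (y : Fin (FLM.m I) → ℚ) (M : Subset (FLM.k I)) (M-match : IsMatching (FLM.G I) M)
  (x̃ : Fin (FLM.m I) → Fin (FLM.k I) → ℚ) (γ : Subset (FLM.k I) → ℚ) (M′ : Subset (FLM.k I)) (0<γM′ : 0ℚ < γ M′)
  (r : ℕ) (1≤r : 1 ℕ.≤ r) (e : ℕ → Fin (FLM.k I)) (v : ℕ → Fin (FLM.n I))
  (walk : ∀ t → 1 ℕ.≤ t → t ℕ.≤ 2 ℕ.* r → Joins (FLM.G I) (e t) (v (pred t)) (v t))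
  (distinct : ∀ t t′ → 1 ℕ.≤ t → t ℕ.≤ 2 ℕ.* r → 1 ℕ.≤ t′ → t′ ℕ.≤ 2 ℕ.* r → e t ≡ e t′ → t ≡ t′)
  (odd∈M′∖M : ∀ s → s ℕ.< r → (e (suc (2 ℕ.* s)) ∈ M′) × (e (suc (2 ℕ.* s)) ∉ M))
  (even∈M∖M′ : ∀ s → s ℕ.< r → (e (2 ℕ.+ 2 ℕ.* s) ∈ M) × (e (2 ℕ.+ 2 ℕ.* s) ∉ M′))
  (path-or-cycle :
      ( (∀ a b → a ℕ.≤ 2 ℕ.* r → b ℕ.≤ 2 ℕ.* r → v a ≡ v b → a ≡ b)
      × (∀ g → ((g ∈ M × g ∉ M′) ⊎ (g ∈ M′ × g ∉ M))
           → (Incident (FLM.G I) (v 0) g ⊎ Incident (FLM.G I) (v (2 ℕ.* r)) g)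
           → ∃ λ t → 1 ℕ.≤ t × t ℕ.≤ 2 ℕ.* r × e t ≡ g) )
    ⊎ ( v 0 ≡ v (2 ℕ.* r)
      × (∀ a b → a ℕ.< 2 ℕ.* r → b ℕ.< 2 ℕ.* r → v a ≡ v b → a ≡ b) ))
  (ι : ℕ → Fin (FLM.m I))
  where

  open FLM I
  open Load I M y

  -- P = e 1, …, e (2r); the s-th transfer moves weight from a s = e (2s+1) ∈ M′ ∖ M to b s = e (2s+2) ∈ M ∖ M′.
  a b : ℕ → Fin k
  a s = e (suc (2 ℕ.* s))
  b s = e (2 ℕ.+ 2 ℕ.* s)

  a-injective : ∀ {s s′} → s ℕ.< r → s′ ℕ.< r → a s ≡ a s′ → s ≡ s′
  a-injective {s} {s′} s<r s′<r as≡as′ = NP.*-cancelˡ-≡ s s′ 2 (NP.suc-injective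
    (distinct _ _ (ℕ.s≤s ℕ.z≤n) (s<r⇒1+2s≤2r s<r) (ℕ.s≤s ℕ.z≤n) (s<r⇒1+2s≤2r s′<r) as≡as′))

  b-injective : ∀ {s s′} → s ℕ.< r → s′ ℕ.< r → b s ≡ b s′ → s ≡ s′
  b-injective {s} {s′} s<r s′<r bs≡bs′ = NP.*-cancelˡ-≡ s s′ 2 (NP.suc-injective (NP.suc-injective
    (distinct _ _ (ℕ.s≤s ℕ.z≤n) (s<r⇒2+2s≤2r s<r) (ℕ.s≤s ℕ.z≤n) (s<r⇒2+2s≤2r s′<r) bs≡bs′)))

  a≢b : ∀ {s s′} → s ℕ.< r → s′ ℕ.< r → a s ≢ b s′
  a≢b {s} {s′} s<r s′<r as≡bs′ = NP.even≢odd s s′ (NP.suc-injective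
    (distinct _ _ (ℕ.s≤s ℕ.z≤n) (s<r⇒1+2s≤2r s<r) (ℕ.s≤s ℕ.z≤n) (s<r⇒2+2s≤2r s′<r) as≡bs′))

  a∈M′ : ∀ {s} → s ℕ.< r → a s ∈ M′
  a∈M′ s<r = proj₁ (odd∈M′∖M _ s<r)

  a∉M : ∀ {s} → s ℕ.< r → a s ∉ M
  a∉M s<r = proj₂ (odd∈M′∖M _ s<r)

  b∈M : ∀ {s} → s ℕ.< r → b s ∈ M
  b∈M s<r = proj₁ (even∈M∖M′ _ s<r)

  b∉M′ : ∀ {s} → s ℕ.< r → b s ∉ M′
  b∉M′ s<r = proj₂ (even∈M∖M′ _ s<r)

  v∼a : ∀ {s} → s ℕ.< r → Incident G (v (suc (2 ℕ.* s))) (a s)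
  v∼a s<r = joins⇒incidentʳ G (walk _ (ℕ.s≤s ℕ.z≤n) (s<r⇒1+2s≤2r s<r))

  v∼b : ∀ {s} → s ℕ.< r → Incident G (v (suc (2 ℕ.* s))) (b s)
  v∼b s<r = joins⇒incidentˡ G (walk _ (ℕ.s≤s ℕ.z≤n) (s<r⇒2+2s≤2r s<r))

  onPath : Fin k → Bool
  onPath g = any (λ t → ⌊ e t FinP.≟ g ⌋) (map suc (upTo (2 ℕ.* r)))

  onPath-e : ∀ t → 1 ℕ.≤ t → t ℕ.≤ 2 ℕ.* r → onPath (e t) ≡ true
  onPath-e (suc t) _ t<2r = Equivalence.to BoolP.T-≡
    (any⁺ _ (lose (∈-map⁺ suc (∈-upTo⁺ t<2r)) (fromWitness {a? = e (suc t) FinP.≟ e (suc t)} refl)))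

  onPath-a : ∀ {s} → s ℕ.< r → onPath (a s) ≡ true
  onPath-a s<r = onPath-e _ (ℕ.s≤s ℕ.z≤n) (s<r⇒1+2s≤2r s<r)

  onPath-b : ∀ {s} → s ℕ.< r → onPath (b s) ≡ true
  onPath-b s<r = onPath-e _ (ℕ.s≤s ℕ.z≤n) (s<r⇒2+2s≤2r s<r)

  onPath⇒position : ∀ {g} → onPath g ≡ true → ∃ λ t → t ℕ.< 2 ℕ.* r × e (suc t) ≡ g
  onPath⇒position {g} g∈P
    with t , t∈ , et≡g ← find (AnyP.map⁻ {f = suc} (any⁻ (λ t → ⌊ e t FinP.≟ g ⌋) (map suc (upTo (2 ℕ.* r)))
                                                      (Equivalence.from BoolP.T-≡ g∈P)))
    = t , ∈-upTo⁻ t∈ , toWitness et≡g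

  data PathView : Fin k → Set where
    source : ∀ {s} → s ℕ.< r → PathView (a s)
    target : ∀ {s} → s ℕ.< r → PathView (b s)
    off    : ∀ {g} → onPath g ≡ false → PathView g

  pathView : ∀ g → PathView g
  pathView g with onPath g in g∈?P
  ... | false = off g∈?P
  ... | true with onPath⇒position g∈?P
  ...   | t , t<2r , refl with t<2r⇒halve {r} t t<2r
  ...     | s , s<r , inj₁ refl = source s<r
  ...     | s , s<r , inj₂ refl = target s<r

  off≢e : ∀ {g t} → onPath g ≡ false → 1 ℕ.≤ t → t ℕ.≤ 2 ℕ.* r → g ≢ e t
  off≢e g∉P 1≤t t≤2r refl with () ← trans (sym (onPath-e _ 1≤t t≤2r)) g∉P

  off≢a : ∀ {g s} → onPath g ≡ false → s ℕ.< r → g ≢ a s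
  off≢a g∉P s<r = off≢e g∉P (ℕ.s≤s ℕ.z≤n) (s<r⇒1+2s≤2r s<r)

  off≢b : ∀ {g s} → onPath g ≡ false → s ℕ.< r → g ≢ b s
  off≢b g∉P s<r = off≢e g∉P (ℕ.s≤s ℕ.z≤n) (s<r⇒2+2s≤2r s<r)

  ε : ℚ
  ε = ⊓-fold (λ s → x̃ (ι s) (a s)) (γ M′) (upTo r)

  ε≤γM′ : ε ≤ γ M′
  ε≤γM′ = ⊓-fold-≤-init _ (γ M′) (upTo r)

  ε≤x̃ : ∀ {s} → s ℕ.< r → ε ≤ x̃ (ι s) (a s)
  ε≤x̃ s<r = ⊓-fold-≤-∈ _ (γ M′) (upTo r) (∈-upTo⁺ s<r)

  0≤ε : (∀ i g → 0ℚ ≤ x̃ i g) → 0ℚ ≤ ε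
  0≤ε 0≤x̃ = ⊓-fold-nonneg _ (upTo r) (QP.<⇒≤ 0<γM′) (λ _ → 0≤x̃ _ _)

  transfers : List ℕ → Fin m → Fin k → ℚ
  transfers = foldr (λ s X → shift I X (ι s) (a s) (b s) ε) x̃

  Untouched : Fin k → List ℕ → Set
  Untouched g = All (λ s → g ≢ a s × g ≢ b s)

  transfers-untouched : ∀ {g} L → Untouched g L → ∀ i → transfers L i g ≡ x̃ i g
  transfers-untouched []      []                          i = refl
  transfers-untouched (s ∷ L) ((g≢as , g≢bs) ∷ untouched) i =
    trans (shift-otherEdge I (transfers L) (ι s) (a s) (b s) ε i g≢as g≢bs) (transfers-untouched L untouched i)

  a-untouched-by : ∀ {s t} → s ℕ.< r → t ℕ.< r → s ≢ t → a s ≢ a t × a s ≢ b t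
  a-untouched-by s<r t<r s≢t = s≢t ∘ a-injective s<r t<r , a≢b s<r t<r

  b-untouched-by : ∀ {s t} → s ℕ.< r → t ℕ.< r → s ≢ t → b s ≢ a t × b s ≢ b t
  b-untouched-by s<r t<r s≢t = a≢b t<r s<r ∘ sym , s≢t ∘ b-injective s<r t<r

  a-untouched : ∀ {s} L → s ℕ.< r → All (s ≢_) L → All (ℕ._< r) L → Untouched (a s) L
  a-untouched []      s<r []          []          = []
  a-untouched (t ∷ L) s<r (s≢t ∷ s≢L) (t<r ∷ L<r) = a-untouched-by s<r t<r s≢t ∷ a-untouched L s<r s≢L L<r

  b-untouched : ∀ {s} L → s ℕ.< r → All (s ≢_) L → All (ℕ._< r) L → Untouched (b s) L
  b-untouched []      s<r []          []          = []
  b-untouched (t ∷ L) s<r (s≢t ∷ s≢L) (t<r ∷ L<r) = b-untouched-by s<r t<r s≢t ∷ b-untouched L s<r s≢L L<r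

  off-untouched : ∀ {g} L → onPath g ≡ false → All (ℕ._< r) L → Untouched g L
  off-untouched L g∉P = All.map (λ t<r → off≢a g∉P t<r , off≢b g∉P t<r)

  transfers-LoadBounded : LoadBounded x̃ → ∀ L → Unique L → All (ℕ._< r) L → LoadBounded (transfers L)
  transfers-LoadBounded bounded []      _              _           = bounded
  transfers-LoadBounded bounded (s ∷ L) (s≢L ∷ unique) (s<r ∷ L<r) =
    shift-LoadBounded (a∉M s<r) (b∈M s<r) (v∼a s<r) (v∼b s<r) (0≤ε (LoadBounded.nonneg bounded))
      (subst (ε ≤_) (sym (transfers-untouched L (a-untouched L s<r s≢L L<r) (ι s))) (ε≤x̃ s<r))
      (transfers-LoadBounded bounded L unique L<r)

  edgeTotal-untouched : ∀ {g} L → Untouched g L → edgeTotal I (transfers L) g ≡ edgeTotal I x̃ g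
  edgeTotal-untouched L untouched = sumFin-cong (transfers-untouched L untouched)

  edgeTotal-transfers-a : ∀ {s} L → Unique L → All (ℕ._< r) L → s ∈ₗ L →
                          edgeTotal I (transfers L) (a s) ≡ edgeTotal I x̃ (a s) - ε
  edgeTotal-transfers-a (s ∷ L) (s≢L ∷ _) (s<r ∷ L<r) (here refl) =
    trans (edgeTotal-shift-source I (transfers L) (ι s) (a s) (b s) ε)
          (cong (_- ε) (edgeTotal-untouched L (a-untouched L s<r s≢L L<r)))
  edgeTotal-transfers-a (t ∷ L) (t≢L ∷ unique) (t<r ∷ L<r) (there s∈L)
    with as≢at , as≢bt ← a-untouched-by (All.lookup L<r s∈L) t<r (All.lookup t≢L s∈L ∘ sym) =
    trans (edgeTotal-shift-other I (transfers L) (ι t) (a t) (b t) ε as≢at as≢bt)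
          (edgeTotal-transfers-a L unique L<r s∈L)

  edgeTotal-transfers-b : ∀ {s} L → Unique L → All (ℕ._< r) L → s ∈ₗ L →
                          edgeTotal I (transfers L) (b s) ≡ edgeTotal I x̃ (b s) + ε
  edgeTotal-transfers-b (s ∷ L) (s≢L ∷ _) (s<r ∷ L<r) (here refl) =
    trans (edgeTotal-shift-target I (transfers L) (ι s) (a s) (b s) ε (a≢b s<r s<r))
          (cong (_+ ε) (edgeTotal-untouched L (b-untouched L s<r s≢L L<r)))
  edgeTotal-transfers-b (t ∷ L) (t≢L ∷ unique) (t<r ∷ L<r) (there s∈L)
    with bs≢at , bs≢bt ← b-untouched-by (All.lookup L<r s∈L) t<r (All.lookup t≢L s∈L ∘ sym) =
    trans (edgeTotal-shift-other I (transfers L) (ι t) (a t) (b t) ε bs≢at bs≢bt)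
          (edgeTotal-transfers-b L unique L<r s∈L)

  x̃′ : Fin m → Fin k → ℚ
  x̃′ = transfers (upTo r)

  upTo-unique : Unique (upTo r)
  upTo-unique = UniqueP.upTo⁺ r

  upTo-< : All (ℕ._< r) (upTo r)
  upTo-< = All.tabulate ∈-upTo⁻

  N : Subset k
  N = tabulate (λ g → lookup M′ g xor onPath g)

  lookup-N : ∀ g → lookup N g ≡ lookup M′ g xor onPath g
  lookup-N g = VecP.lookup∘tabulate (λ g → lookup M′ g xor onPath g) g

  N-a : ∀ {s} → s ℕ.< r → lookup N (a s) ≡ false
  N-a {s} s<r rewrite lookup-N (a s) | ∈⇒lookup (a∈M′ s<r) | onPath-a s<r = refl

  N-b : ∀ {s} → s ℕ.< r → lookup N (b s) ≡ true
  N-b {s} s<r rewrite lookup-N (b s) | ∉⇒lookup (b∉M′ s<r) | onPath-b s<r = refl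

  N-off : ∀ {g} → onPath g ≡ false → lookup N g ≡ lookup M′ g
  N-off {g} g∉P rewrite lookup-N g | g∉P with lookup M′ g
  ... | true  = refl
  ... | false = refl

  edgeTotal-x̃′ : ∀ g → edgeTotal I x̃′ g
    ≡ (edgeTotal I x̃ g + (if lookup M′ g then 0ℚ - ε else 0ℚ)) + (if lookup N g then ε else 0ℚ)
  edgeTotal-x̃′ g with pathView g
  ... | source {s} s<r rewrite ∈⇒lookup (a∈M′ s<r) | N-a s<r =
    trans (edgeTotal-transfers-a (upTo r) upTo-unique upTo-< (∈-upTo⁺ s<r))
          (solve 2 (λ T e → T :- e := (T :+ (con 0ℚ :- e)) :+ con 0ℚ) refl (edgeTotal I x̃ (a s)) ε)
  ... | target {s} s<r rewrite ∉⇒lookup (b∉M′ s<r) | N-b s<r =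
    trans (edgeTotal-transfers-b (upTo r) upTo-unique upTo-< (∈-upTo⁺ s<r))
          (solve 2 (λ T e → T :+ e := (T :+ con 0ℚ) :+ e) refl (edgeTotal I x̃ (b s)) ε)
  ... | off g∉P rewrite N-off g∉P =
    trans (edgeTotal-untouched (upTo r) (off-untouched (upTo r) g∉P upTo-<)) (unchanged (lookup M′ g))
    where
    unchanged : ∀ c → edgeTotal I x̃ g ≡ (edgeTotal I x̃ g + (if c then 0ℚ - ε else 0ℚ)) + (if c then ε else 0ℚ)
    unchanged true  = solve 2 (λ T e → T := (T :+ (con 0ℚ :- e)) :+ e) refl (edgeTotal I x̃ g) ε
    unchanged false = solve 1 (λ T → T := (T :+ con 0ℚ) :+ con 0ℚ) refl (edgeTotal I x̃ g)

  N-edge : ∀ {g} → g ∈ N → (∃ λ s → s ℕ.< r × g ≡ b s) ⊎ (onPath g ≡ false × g ∈ M′)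
  N-edge {g} g∈N with pathView g
  ... | source s<r with () ← trans (sym (∈⇒lookup g∈N)) (N-a s<r)
  ... | target s<r = inj₁ (_ , s<r , refl)
  ... | off g∉P    = inj₂ (g∉P , lookup⇒∈ (trans (sym (N-off g∉P)) (∈⇒lookup g∈N)))

  b-endpoint-covered : ∀ {s w} → s ℕ.< r → Incident G w (b s) → (∃ λ t → t ℕ.< r × Incident G w (a t)) ⊎ w ≡ v (2 ℕ.* r)
  b-endpoint-covered {s} s<r w∼bs with incident-joins G w∼bs (walk _ (ℕ.s≤s ℕ.z≤n) (s<r⇒2+2s≤2r s<r))
  ... | inj₁ refl = inj₁ (s , s<r , v∼a s<r)
  ... | inj₂ refl with suc s ℕ.<? r
  ...   | yes s+1<r = inj₁ (suc s , s+1<r , subst (λ u → Incident G u (a (suc s))) (cong v (NP.*-suc 2 s))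
                                                 (joins⇒incidentˡ G (walk _ (ℕ.s≤s ℕ.z≤n) (s<r⇒1+2s≤2r s+1<r))))
  ...   | no s+1≮r  = inj₂ (cong v (trans (sym (NP.*-suc 2 s)) (cong (2 ℕ.*_) (NP.≤-antisym s<r (NP.≮⇒≥ s+1≮r)))))

  -- The only place where maximality of the path, or closedness of the cycle, is needed.
  off-M′-avoids-b : IsMatching G M′ → ∀ {g s w} → s ℕ.< r → onPath g ≡ false → g ∈ M′ →
                    Incident G w g → Incident G w (b s) → ⊥
  off-M′-avoids-b M′-match {g} s<r g∉P g∈M′ w∼g w∼bs with b-endpoint-covered s<r w∼bs
  ... | inj₁ (t , t<r , w∼at) = off≢a g∉P t<r (matching-unique G M′-match g∈M′ (a∈M′ t<r) w∼g w∼at)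
  ... | inj₂ refl with g ∈? M
  ...   | yes g∈M = off≢b g∉P s<r (matching-unique G M-match g∈M (b∈M s<r) w∼g w∼bs)
  ...   | no  g∉M =
    [ (λ (_ , maximal) → let t , 1≤t , t≤2r , et≡g = maximal g (inj₂ (g∈M′ , g∉M)) (inj₂ w∼g)
                         in off≢e g∉P 1≤t t≤2r (sym et≡g))
    , (λ (v0≡v2r , _) → off≢a g∉P 1≤r (matching-unique G M′-match g∈M′ (a∈M′ 1≤r) w∼g
         (subst (λ u → Incident G u (a 0)) v0≡v2r (joins⇒incidentˡ G (walk 1 (ℕ.s≤s ℕ.z≤n) (s<r⇒1+2s≤2r 1≤r))))))
    ]′ path-or-cycle

  N-matching : IsMatching G M′ → IsMatching G N
  N-matching M′-match g g′ g∈N g′∈N g≢g′ w (w∼g , w∼g′) with N-edge g∈N | N-edge g′∈N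
  ... | inj₁ (s , s<r , refl) | inj₁ (s′ , s′<r , refl) = g≢g′ (matching-unique G M-match (b∈M s<r) (b∈M s′<r) w∼g w∼g′)
  ... | inj₁ (s , s<r , refl) | inj₂ (g′∉P , g′∈M′)     = off-M′-avoids-b M′-match s<r g′∉P g′∈M′ w∼g′ w∼g
  ... | inj₂ (g∉P , g∈M′)     | inj₁ (s′ , s′<r , refl) = off-M′-avoids-b M′-match s′<r g∉P g∈M′ w∼g w∼g′
  ... | inj₂ (g∉P , g∈M′)     | inj₂ (g′∉P , g′∈M′)     = g≢g′ (matching-unique G M′-match g∈M′ g′∈M′ w∼g w∼g′)

  swapAlong : List ℕ → Fin k → Fin k
  swapAlong []      g = g
  swapAlong (s ∷ L) g = if ⌊ g FinP.≟ a s ⌋ then b s else if ⌊ g FinP.≟ b s ⌋ then a s else swapAlong L g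

  swapAlong-untouched : ∀ {g} L → Untouched g L → swapAlong L g ≡ g
  swapAlong-untouched         []      []                    = refl
  swapAlong-untouched {g} (s ∷ L) ((g≢as , g≢bs) ∷ untouched)
    rewrite ⌊⌋-no (g FinP.≟ a s) g≢as | ⌊⌋-no (g FinP.≟ b s) g≢bs = swapAlong-untouched L untouched

  swapAlong-a : ∀ {s} L → Unique L → All (ℕ._< r) L → s ∈ₗ L → swapAlong L (a s) ≡ b s
  swapAlong-a {s} (s ∷ L) _ _ (here refl) rewrite ⌊⌋-yes (a s FinP.≟ a s) refl = refl
  swapAlong-a {s} (t ∷ L) (t≢L ∷ unique) (t<r ∷ L<r) (there s∈L)
    with as≢at , as≢bt ← a-untouched-by (All.lookup L<r s∈L) t<r (All.lookup t≢L s∈L ∘ sym)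
    rewrite ⌊⌋-no (a s FinP.≟ a t) as≢at | ⌊⌋-no (a s FinP.≟ b t) as≢bt = swapAlong-a L unique L<r s∈L

  swapAlong-b : ∀ {s} L → Unique L → All (ℕ._< r) L → s ∈ₗ L → swapAlong L (b s) ≡ a s
  swapAlong-b {s} (s ∷ L) _ (s<r ∷ _) (here refl)
    rewrite ⌊⌋-no (b s FinP.≟ a s) (a≢b s<r s<r ∘ sym) | ⌊⌋-yes (b s FinP.≟ b s) refl = refl
  swapAlong-b {s} (t ∷ L) (t≢L ∷ unique) (t<r ∷ L<r) (there s∈L)
    with bs≢at , bs≢bt ← b-untouched-by (All.lookup L<r s∈L) t<r (All.lookup t≢L s∈L ∘ sym)
    rewrite ⌊⌋-no (b s FinP.≟ a t) bs≢at | ⌊⌋-no (b s FinP.≟ b t) bs≢bt = swapAlong-b L unique L<r s∈L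

  σ : Fin k → Fin k
  σ = swapAlong (upTo r)

  σ-a : ∀ {s} → s ℕ.< r → σ (a s) ≡ b s
  σ-a s<r = swapAlong-a (upTo r) upTo-unique upTo-< (∈-upTo⁺ s<r)

  σ-b : ∀ {s} → s ℕ.< r → σ (b s) ≡ a s
  σ-b s<r = swapAlong-b (upTo r) upTo-unique upTo-< (∈-upTo⁺ s<r)

  σ-off : ∀ {g} → onPath g ≡ false → σ g ≡ g
  σ-off g∉P = swapAlong-untouched (upTo r) (off-untouched (upTo r) g∉P upTo-<)

  σ-involutive : ∀ g → σ (σ g) ≡ g
  σ-involutive g with pathView g
  ... | source s<r = trans (cong σ (σ-a s<r)) (σ-b s<r)
  ... | target s<r = trans (cong σ (σ-b s<r)) (σ-a s<r)
  ... | off g∉P    = trans (cong σ (σ-off g∉P)) (σ-off g∉P)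

  M′∘σ≡N : ∀ g → lookup M′ (σ g) ≡ lookup N g
  M′∘σ≡N g with pathView g
  ... | source s<r = trans (cong (lookup M′) (σ-a s<r)) (trans (∉⇒lookup (b∉M′ s<r)) (sym (N-a s<r)))
  ... | target s<r = trans (cong (lookup M′) (σ-b s<r)) (trans (∈⇒lookup (a∈M′ s<r)) (sym (N-b s<r)))
  ... | off g∉P    = trans (cong (lookup M′) (σ-off g∉P)) (sym (N-off g∉P))

  N-maximum : IsMaximumMatching G M′ → IsMaximumMatching G N
  N-maximum (M′-match , M′-maximum) = N-matching M′-match , λ N′ N′-match →
    subst (∣ N′ ∣ ℕ.≤_) (sym (∣∣-involution M′ N σ σ-involutive M′∘σ≡N)) (M′-maximum N′ N′-match)

  γ′ : Subset k → ℚ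
  γ′ = bump I (bump I γ M′ (0ℚ - ε)) N ε

  x̃′-decomposition : LoadBounded x̃ → IsMMDecomposition G (edgeTotal I x̃) γ → IsMMDecomposition G (edgeTotal I x̃′) γ′
  x̃′-decomposition bounded decomposition@(_ , γ-support , _ , _) =
    IsMMDecomposition-exchange I decomposition M′-maximum (N-maximum M′-maximum)
      (0≤ε (LoadBounded.nonneg bounded)) ε≤γM′ edgeTotal-x̃′
    where
    M′-maximum : IsMaximumMatching G M′
    M′-maximum = γ-support M′ (λ γM′≡0 → QP.<-irrefl (sym γM′≡0) 0<γM′)

module Invariance (I : FLM) (y : Fin (FLM.m I) → ℚ) (M : Subset (FLM.k I)) (M-match : IsMatching (FLM.G I) M) where
  open FLM I
  open Load I M y

  Invariant : State I → Set
  Invariant s = LoadBounded (State.xt s) × IsMMDecomposition G (edgeTotal I (State.xt s)) (State.γ s)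

  step-preserves-Invariant : ∀ {s s′} → Step I M s s′ → Invariant s → Invariant s′
  -- Neither γ M < 1, nor M′ ≢ M, nor the positivity of the chosen entries of x̃ is needed.
  step-preserves-Invariant
    (step x̃ γ _ M′ _ 0<γM′ r 1≤r e v walk distinct odd∈M′∖M even∈M∖M′ path-or-cycle ι _) (bounded , decomposition) =
    transfers-LoadBounded bounded (upTo r) upTo-unique upTo-< , x̃′-decomposition bounded decomposition
    where
    open Iteration I y M M-match x̃ γ M′ 0<γM′ r 1≤r e v walk distinct odd∈M′∖M even∈M∖M′ path-or-cycle ι

  Star-preserves-Invariant : ∀ {s s′} → Star (Step I M) s s′ → Invariant s → Invariant s′
  Star-preserves-Invariant = RT.fold (λ s s′ → Invariant s → Invariant s′) (λ st next → next ∘ step-preserves-Invariant st) id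

lemma3 : (I : FLM) (x : Fin (FLM.m I) → Fin (FLM.k I) → ℚ) (y : Fin (FLM.m I) → ℚ)
         → Feasible I x y
         → (M : Subset (FLM.k I)) → IsMaximumMatching (FLM.G I) M
         → (γ₀ : Subset (FLM.k I) → ℚ)
         → IsMMDecomposition (FLM.G I) (λ e → sumFin (λ i → x i e)) γ₀
         → (s : State I) → Star (Step I M) ⟨ x , γ₀ ⟩ s
         → Feasible I (State.xt s) (λ i → y i + y i)
lemma3 I x y (_ , load≤y , 0≤x , 0≤y) M (M-match , _) γ₀ decomposition₀ s steps =
  (State.γ s , proj₂ invariant) , LoadBounded⇒load≤2y M-match 0≤y (proj₁ invariant)
  , LoadBounded.nonneg (proj₁ invariant) , λ i → 0≤+ (0≤y i) (0≤y i)
  where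
  open Load I M y
  open Invariance I y M M-match
  invariant : Invariant s
  invariant = Star-preserves-Invariant steps (LoadBounded-init 0≤x load≤y , decomposition₀)
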